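{- Let $A$ be a unital ring, $n\geq4$, and $\tau\in\mathfrak S_n$ a product of two transpositions with disjoint supports. Then for every finitely generated projective right $A$-module $P$, the element $[P,\tau,P]$ of $K_1(A;\mathbf Z/n)$ is zero, where $\tau$ acts on $P^{\oplus n}$ by $(z_1,\dots,z_n)\mapsto(z_{\tau(1)},\dots,z_{\tau(n)})$.
   Context: $K_1(A;\mathbf Z/n)$: consider triples $(P,\alpha,Q)$ with $P,Q$ finitely generated projective right $A$-modules and $\alpha:P^{\oplus n}\to Q^{\oplus n}$ an $A$-isomorphism; an isomorphism of triples is a pair of isomorphisms $f:P\to P'$, $g:Q\to Q'$ with $g^{\oplus n}\circ\alpha=\alpha'\circ f^{\oplus n}$; $K_1(A;\mathbf Z/n)$ is the Grothendieck group of isomorphism classes (under direct sum) modulo the subgroup generated by $(P,\alpha,Q)+(Q,\beta,R)-(P,\beta\alpha,R)$; $[P,\alpha,Q]$ denotes the class. -}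

module Defs where

open import Level using (Level; _⊔_; suc)
open import Algebra.Bundles using (Ring)
open import Algebra.Module.Bundles using (RightModule)
open import Algebra.Module.Morphism.Structures using (module RightModuleMorphisms)
import Algebra.Module.Construct.DirectProduct as DP
import Algebra.Module.Construct.TensorUnit as TU
import Algebra.Construct.Pointwise as PW
open import Data.Nat using (ℕ)
open import Data.Fin using (Fin)
open import Data.Fin.Permutation using (Permutation; _⟨$⟩ʳ_; _⟨$⟩ˡ_; transpose; inverseʳ; inverseˡ)
open import Data.Product using (Σ; ∃; _×_; _,_; proj₁; proj₂)
open import Relation.Binary.PropositionalEquality using (_≡_; _≢_; subst)

module _ {r ℓr : Level} (A : Ring r ℓr) where

  IsIso : ∀ {m₁ ℓ₁ m₂ ℓ₂} (M : RightModule A m₁ ℓ₁) (N : RightModule A m₂ ℓ₂) →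
          (RightModule.Carrierᴹ M → RightModule.Carrierᴹ N) → Set _
  IsIso M N f = RightModuleMorphisms.IsRightModuleIsomorphism
                  (RightModule.rawRightModule M) (RightModule.rawRightModule N) f

  IsHom : ∀ {m₁ ℓ₁ m₂ ℓ₂} (M : RightModule A m₁ ℓ₁) (N : RightModule A m₂ ℓ₂) →
          (RightModule.Carrierᴹ M → RightModule.Carrierᴹ N) → Set _
  IsHom M N f = RightModuleMorphisms.IsRightModuleHomomorphism
                  (RightModule.rawRightModule M) (RightModule.rawRightModule N) f

  power : ∀ {m ℓm} → RightModule A m ℓm → ℕ → RightModule A m ℓm
  power M n = record
    { Carrierᴹ = Fin n → M.Carrierᴹ
    ; _≈ᴹ_ = λ x y → ∀ i → x i M.≈ᴹ y i
    ; _+ᴹ_ = λ x y i → x i M.+ᴹ y i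
    ; _*ᵣ_ = λ x a i → x i M.*ᵣ a
    ; 0ᴹ = λ _ → M.0ᴹ
    ; -ᴹ_ = λ x i → M.-ᴹ x i
    ; isRightModule = record
      { isRightSemimodule = record
        { +ᴹ-isCommutativeMonoid = PW.isCommutativeMonoid (Fin n) M.+ᴹ-isCommutativeMonoid
        ; isPrerightSemimodule = record
          { *ᵣ-cong = λ xx aa i → M.*ᵣ-cong (xx i) aa
          ; *ᵣ-zeroʳ = λ x i → M.*ᵣ-zeroʳ (x i)
          ; *ᵣ-distribˡ = λ x a b i → M.*ᵣ-distribˡ (x i) a b
          ; *ᵣ-identityʳ = λ x i → M.*ᵣ-identityʳ (x i)
          ; *ᵣ-assoc = λ x a b i → M.*ᵣ-assoc (x i) a b
          ; *ᵣ-zeroˡ = λ a i → M.*ᵣ-zeroˡ a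
          ; *ᵣ-distribʳ = λ a x y i → M.*ᵣ-distribʳ a (x i) (y i)
          }
        }
      ; -ᴹ‿cong = λ xx i → M.-ᴹ‿cong (xx i)
      ; -ᴹ‿inverse = (λ x i → M.-ᴹ‿inverseˡ (x i)) , (λ x i → M.-ᴹ‿inverseʳ (x i))
      }
    } where module M = RightModule M

  Aᴬ : RightModule A r ℓr
  Aᴬ = TU.rightModule {R = A}

  -- P is finitely generated projective: a direct summand of some A^k,
  -- i.e. there are A-linear i : P → A^k, p : A^k → P with p ∘ i = id.
  IsFGProjective : ∀ {m ℓm} → RightModule A m ℓm → Set _
  IsFGProjective P =
    Σ ℕ λ k →
    Σ (RightModule.Carrierᴹ P → RightModule.Carrierᴹ (power Aᴬ k)) λ i →
    Σ (RightModule.Carrierᴹ (power Aᴬ k) → RightModule.Carrierᴹ P) λ p →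
      IsHom P (power Aᴬ k) i × IsHom (power Aᴬ k) P p ×
      (∀ x → RightModule._≈ᴹ_ P (p (i x)) x)

  module _ (m ℓm : Level) where

    record FGP : Set (r ⊔ ℓr ⊔ suc (m ⊔ ℓm)) where
      constructor fgp
      field
        mod   : RightModule A m ℓm
        isFGP : IsFGProjective mod
    open FGP public

  module _ {m ℓm : Level} (n : ℕ) where

    Pow : FGP m ℓm → RightModule A m ℓm
    Pow P = power (mod P) n

    Elt : RightModule A m ℓm → Set m
    Elt = RightModule.Carrierᴹ

    record Triple : Set (r ⊔ ℓr ⊔ suc (m ⊔ ℓm)) where
      constructor triple
      field
        P Q   : FGP m ℓm
        α     : Elt (Pow P) → Elt (Pow Q)
        α-iso : IsIso (Pow P) (Pow Q) α
    open Triple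

    pow : ∀ {X Y : Set m} → (X → Y) → (Fin n → X) → (Fin n → Y)
    pow f z i = f (z i)

    TripleIso : Triple → Triple → Set _
    TripleIso T T′ =
      Σ (Elt (mod (P T)) → Elt (mod (P T′))) λ f →
      Σ (Elt (mod (Q T)) → Elt (mod (Q T′))) λ g →
        IsIso (mod (P T)) (mod (P T′)) f × IsIso (mod (Q T)) (mod (Q T′)) g ×
        (∀ z → RightModule._≈ᴹ_ (Pow (Q T′)) (pow g (α T z)) (α T′ (pow f z)))

    -- T is isomorphic to the direct sum T₁ ⊕ T₂ = (P₁⊕P₂, α₁⊕α₂, Q₁⊕Q₂),
    -- where (P₁⊕P₂)^{⊕n} is identified with P₁^{⊕n} ⊕ P₂^{⊕n} componentwise.
    IsSumOf : Triple → Triple → Triple → Set _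
    IsSumOf T T₁ T₂ =
      Σ (Elt (mod (P T)) → Elt PP) λ f →
      Σ (Elt (mod (Q T)) → Elt QQ) λ g →
        IsIso (mod (P T)) PP f × IsIso (mod (Q T)) QQ g ×
        (∀ z → RightModule._≈ᴹ_ (power QQ n) (pow g (α T z)) (sumMap (pow f z)))
      where
      PP = DP.rightModule (mod (P T₁)) (mod (P T₂))
      QQ = DP.rightModule (mod (Q T₁)) (mod (Q T₂))
      sumMap : Elt (power PP n) → Elt (power QQ n)
      sumMap w i = α T₁ (λ j → proj₁ (w j)) i , α T₂ (λ j → proj₂ (w j)) i

    -- Formal expressions in the free abelian group on triples.
    infixl 6 _⊕_
    data Expr : Set (r ⊔ ℓr ⊔ suc (m ⊔ ℓm)) where
      gen  : Triple → Expr
      𝟘    : Expr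
      _⊕_  : Expr → Expr → Expr
      ⊝_   : Expr → Expr

    -- Equality in K₁(A; Z/n): the congruence generated by the abelian
    -- group axioms, isomorphism invariance, additivity under direct sum
    -- (Grothendieck group of the monoid of iso classes) and the relation
    -- (P,α,Q) + (Q,β,R) = (P,βα,R).
    infix 4 _∼_
    data _∼_ : Expr → Expr → Set (r ⊔ ℓr ⊔ suc (m ⊔ ℓm)) where
      ∼-refl  : ∀ {x} → x ∼ x
      ∼-sym   : ∀ {x y} → x ∼ y → y ∼ x
      ∼-trans : ∀ {x y z} → x ∼ y → y ∼ z → x ∼ z
      ⊕-cong  : ∀ {x x′ y y′} → x ∼ x′ → y ∼ y′ → x ⊕ y ∼ x′ ⊕ y′
      ⊝-cong  : ∀ {x x′} → x ∼ x′ → ⊝ x ∼ ⊝ x′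
      ⊕-assoc : ∀ x y z → (x ⊕ y) ⊕ z ∼ x ⊕ (y ⊕ z)
      ⊕-comm  : ∀ x y → x ⊕ y ∼ y ⊕ x
      ⊕-idˡ   : ∀ x → 𝟘 ⊕ x ∼ x
      ⊝-invˡ  : ∀ x → (⊝ x) ⊕ x ∼ 𝟘
      iso     : ∀ {T T′} → TripleIso T T′ → gen T ∼ gen T′
      sum     : ∀ {T T₁ T₂} → IsSumOf T T₁ T₂ → gen T ∼ gen T₁ ⊕ gen T₂
      comp    : ∀ (P Q R : FGP m ℓm)
                  (α : Elt (Pow P) → Elt (Pow Q)) (α-iso : IsIso (Pow P) (Pow Q) α)
                  (β : Elt (Pow Q) → Elt (Pow R)) (β-iso : IsIso (Pow Q) (Pow R) β)
                  (γ : Elt (Pow P) → Elt (Pow R)) (γ-iso : IsIso (Pow P) (Pow R) γ) →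
                  (∀ z → RightModule._≈ᴹ_ (Pow R) (γ z) (β (α z))) →
                  gen (triple P Q α α-iso) ⊕ gen (triple Q R β β-iso) ∼ gen (triple P R γ γ-iso)

  permAct : ∀ {m} {X : Set m} {n} → Permutation n n → (Fin n → X) → (Fin n → X)
  permAct τ z i = z (τ ⟨$⟩ʳ i)

  permAct-iso : ∀ {m ℓm} (M : RightModule A m ℓm) {n} (τ : Permutation n n) →
                IsIso (power M n) (power M n) (permAct τ)
  permAct-iso M {n} τ = record
    { isRightModuleMonomorphism = record
      { isRightModuleHomomorphism = record
        { +ᴹ-isGroupHomomorphism = record
          { isMonoidHomomorphism = record
            { isMagmaHomomorphism = record
              { isRelHomomorphism = record { cong = λ eq i → eq (τ ⟨$⟩ʳ i) }
              ; homo = λ x y i → M.≈ᴹ-refl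
              }
            ; ε-homo = λ i → M.≈ᴹ-refl
            }
          ; ⁻¹-homo = λ x i → M.≈ᴹ-refl
          }
        ; *ᵣ-homo = λ a x i → M.≈ᴹ-refl
        }
      ; injective = λ {x} {y} eq i →
          subst (λ j → x j M.≈ᴹ y j) (inverseʳ τ) (eq (τ ⟨$⟩ˡ i))
      }
    ; surjective = λ y → (λ j → y (τ ⟨$⟩ˡ j)) , λ {z} eq i →
        subst (λ j → z (τ ⟨$⟩ʳ i) M.≈ᴹ y j) (inverseˡ τ) (eq (τ ⟨$⟩ʳ i))
    } where module M = RightModule M

  permTriple : ∀ {m ℓm} {n} → FGP m ℓm → Permutation n n → Triple n
  permTriple {n = n} P τ = triple P P (permAct τ) (permAct-iso (mod P) τ)

IsDoubleTransposition : ∀ {n} → Permutation n n → Set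
IsDoubleTransposition {n} τ =
  Σ (Fin n) λ a → Σ (Fin n) λ b → Σ (Fin n) λ c → Σ (Fin n) λ d →
    a ≢ b × c ≢ d × a ≢ c × a ≢ d × b ≢ c × b ≢ d ×
    (∀ i → τ ⟨$⟩ʳ i ≡ transpose a b ⟨$⟩ʳ (transpose c d ⟨$⟩ʳ i))

{-# OPTIONS --safe #-}
-- The assignment σ ↦ [P, σ, P] is a homomorphism from 𝔖ₙ into the abelian
-- group K₁(A; Z/n): the composition relation gives [P,σ,P] + [P,ρ,P] = [P,σρ,P].
-- A homomorphism into an abelian group is constant on conjugacy classes, and
-- the transpositions (a b) and (c d) = g (b a) g⁻¹ are conjugate.  Hence
-- [P,τ,P] = [P,(a b),P] + [P,(b a),P] = [P,id,P] = 0.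
module Submission where

open import Defs
open import Level using (Level)
open import Algebra.Bundles using (Ring; AbelianGroup)
open import Algebra.Module.Bundles using (RightModule)
open import Data.Nat using (ℕ; _≤_)
open import Data.Fin using (Fin)
open import Data.Fin.Properties using (_≟_)
open import Data.Fin.Permutation
  using ( Permutation; Permutation′; _⟨$⟩ʳ_; _⟨$⟩ˡ_; inverseʳ
        ; id; flip; transpose; _∘ₚ_)
import Data.Fin.Permutation.Components as PC
open import Data.Product using (_,_)
open import Function using (_∘_)
open import Function.Bundles using (Injection)
open import Function.Properties.Inverse using (↔⇒↣)
open import Relation.Nullary using (Dec; yes; no; contradiction)
open import Relation.Binary.PropositionalEquality
  using (_≡_; _≢_; refl; sym; trans; cong; subst; module ≡-Reasoning)

module _ {n : ℕ} where

  transpose-matchˡ : ∀ (i j : Fin n) → PC.transpose i j i ≡ j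
  transpose-matchˡ i j with i ≟ i
  ... | yes _   = refl
  ... | no i≢i = contradiction refl i≢i

  transpose-matchʳ : ∀ (i j : Fin n) → PC.transpose i j j ≡ i
  transpose-matchʳ i j with j ≟ i
  ... | yes j≡i = j≡i
  ... | no _ with j ≟ j
  ...   | yes _   = refl
  ...   | no j≢j = contradiction refl j≢j

  transpose-other : ∀ {i j k : Fin n} → k ≢ i → k ≢ j → PC.transpose i j k ≡ k
  transpose-other {i} {j} {k} k≢i k≢j with k ≟ i
  ... | yes k≡i = contradiction k≡i k≢i
  ... | no _ with k ≟ j
  ...   | yes k≡j = contradiction k≡j k≢j
  ...   | no _    = refl

  transpose-∘ : ∀ (g : Permutation′ n) i j k →
                PC.transpose (g ⟨$⟩ʳ i) (g ⟨$⟩ʳ j) (g ⟨$⟩ʳ k) ≡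
                g ⟨$⟩ʳ PC.transpose i j k
  transpose-∘ g i j k = by-cases (k ≟ i) (k ≟ j)
    where
    gi = g ⟨$⟩ʳ i
    gj = g ⟨$⟩ʳ j

    g-injective : ∀ {x y} → g ⟨$⟩ʳ x ≡ g ⟨$⟩ʳ y → x ≡ y
    g-injective = Injection.injective (↔⇒↣ g)

    by-cases : Dec (k ≡ i) → Dec (k ≡ j) →
               PC.transpose gi gj (g ⟨$⟩ʳ k) ≡ g ⟨$⟩ʳ PC.transpose i j k
    by-cases (yes refl) _ =
      trans (transpose-matchˡ gi gj) (cong (g ⟨$⟩ʳ_) (sym (transpose-matchˡ i j)))
    by-cases (no _) (yes refl) =
      trans (transpose-matchʳ gi gj) (cong (g ⟨$⟩ʳ_) (sym (transpose-matchʳ i j)))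
    by-cases (no k≢i) (no k≢j) =
      trans (transpose-other (k≢i ∘ g-injective) (k≢j ∘ g-injective))
            (cong (g ⟨$⟩ʳ_) (sym (transpose-other k≢i k≢j)))

  transpose-conjugate : ∀ (g : Permutation′ n) i j k →
                        PC.transpose (g ⟨$⟩ʳ i) (g ⟨$⟩ʳ j) k ≡
                        g ⟨$⟩ʳ PC.transpose i j (g ⟨$⟩ˡ k)
  transpose-conjugate g i j k = begin
    PC.transpose (g ⟨$⟩ʳ i) (g ⟨$⟩ʳ j) k
      ≡⟨ cong (PC.transpose _ _) (sym (inverseʳ g)) ⟩
    PC.transpose (g ⟨$⟩ʳ i) (g ⟨$⟩ʳ j) (g ⟨$⟩ʳ (g ⟨$⟩ˡ k))
      ≡⟨ transpose-∘ g i j (g ⟨$⟩ˡ k) ⟩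
    g ⟨$⟩ʳ PC.transpose i j (g ⟨$⟩ˡ k)
      ∎
    where open ≡-Reasoning

module PermutationHomomorphism
  {c ℓ} (G : AbelianGroup c ℓ) {n : ℕ}
  (φ : Permutation′ n → AbelianGroup.Carrier G)
  (homo : ∀ {σ ρ γ} → (∀ i → γ ⟨$⟩ʳ i ≡ σ ⟨$⟩ʳ (ρ ⟨$⟩ʳ i)) →
          AbelianGroup._≈_ G (AbelianGroup._∙_ G (φ σ) (φ ρ)) (φ γ))
  where

  open AbelianGroup G using (_≈_; _∙_; ε; _⁻¹; setoid; ∙-congˡ; ∙-congʳ)
  open import Algebra.Properties.AbelianGroup G
    using (identityʳ-unique; inverseʳ-unique; xyx⁻¹≈y)
  open import Relation.Binary.Reasoning.Setoid setoid

  ε-homo : φ id ≈ ε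
  ε-homo = identityʳ-unique (φ id) (φ id) (homo λ _ → refl)

  ⁻¹-homo : ∀ g → φ (flip g) ≈ φ g ⁻¹
  ⁻¹-homo g = inverseʳ-unique (φ g) (φ (flip g)) (begin
    φ g ∙ φ (flip g)  ≈⟨ homo (λ _ → sym (inverseʳ g)) ⟩
    φ id              ≈⟨ ε-homo ⟩
    ε                 ∎)

  conjugate-invariant : ∀ g σ τ → (∀ i → τ ⟨$⟩ʳ i ≡ g ⟨$⟩ʳ (σ ⟨$⟩ʳ (g ⟨$⟩ˡ i))) →
                        φ τ ≈ φ σ
  conjugate-invariant g σ τ τ≡gσg⁻¹ = begin
    φ τ                          ≈⟨ homo τ≡gσg⁻¹ ⟨
    φ (σ ∘ₚ g) ∙ φ (flip g)      ≈⟨ ∙-congʳ (homo λ _ → refl) ⟨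
    φ g ∙ φ σ ∙ φ (flip g)       ≈⟨ ∙-congˡ (⁻¹-homo g) ⟩
    φ g ∙ φ σ ∙ φ g ⁻¹           ≈⟨ xyx⁻¹≈y (φ g) (φ σ) ⟩
    φ σ                          ∎

  transpose-invariant : ∀ g {i j k l} → g ⟨$⟩ʳ i ≡ k → g ⟨$⟩ʳ j ≡ l →
                        φ (transpose k l) ≈ φ (transpose i j)
  transpose-invariant g {i} {j} refl refl =
    conjugate-invariant g (transpose i j) (transpose (g ⟨$⟩ʳ i) (g ⟨$⟩ʳ j))
                        (transpose-conjugate g i j)

  doubleTransposition⇒≈ε : ∀ τ → IsDoubleTransposition τ → φ τ ≈ ε
  doubleTransposition⇒≈ε τ (a , b , c , d , a≢b , c≢d , a≢c , _ , _ , _ , τ≡[ab][cd]) =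
    begin
    φ τ                                    ≈⟨ homo τ≡[ab][cd] ⟨
    φ (transpose a b) ∙ φ (transpose c d)  ≈⟨ ∙-congˡ (transpose-invariant g g⟨b⟩≡c g⟨a⟩≡d) ⟩
    φ (transpose a b) ∙ φ (transpose b a)  ≈⟨ homo (λ _ → sym (PC.transpose-inverse a b)) ⟩
    φ id                                   ≈⟨ ε-homo ⟩
    ε                                      ∎
    where
    g : Permutation′ n
    g = transpose b c ∘ₚ transpose a d
    g⟨b⟩≡c : g ⟨$⟩ʳ b ≡ c
    g⟨b⟩≡c = trans (cong (PC.transpose a d) (transpose-matchˡ b c))
                   (transpose-other (a≢c ∘ sym) c≢d)
    g⟨a⟩≡d : g ⟨$⟩ʳ a ≡ d
    g⟨a⟩≡d = trans (cong (PC.transpose a d) (transpose-other a≢b a≢c))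
                   (transpose-matchˡ a d)

module _ {r ℓr : Level} (A : Ring r ℓr) (m ℓm : Level) (n : ℕ) where

  K₁-abelianGroup : AbelianGroup _ _
  K₁-abelianGroup = record
    { Carrier = Expr A {m} {ℓm} n
    ; _≈_ = _∼_ A n
    ; _∙_ = _⊕_
    ; ε = 𝟘
    ; _⁻¹ = ⊝_
    ; isAbelianGroup = record
      { isGroup = record
        { isMonoid = record
          { isSemigroup = record
            { isMagma = record
              { isEquivalence = record { refl = ∼-refl ; sym = ∼-sym ; trans = ∼-trans }
              ; ∙-cong = ⊕-cong
              }
            ; assoc = ⊕-assoc
            }
          ; identity = ⊕-idˡ , λ x → ∼-trans (⊕-comm x 𝟘) (⊕-idˡ x)
          }
        ; inverse = ⊝-invˡ , λ x → ∼-trans (⊕-comm x (⊝ x)) (⊝-invˡ x)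
        ; ⁻¹-cong = ⊝-cong
        }
      ; comm = ⊕-comm
      }
    }

  permTriple-homo : ∀ (P : FGP A m ℓm) {σ ρ γ} → (∀ i → γ ⟨$⟩ʳ i ≡ σ ⟨$⟩ʳ (ρ ⟨$⟩ʳ i)) →
                    _∼_ A n (gen (permTriple A P σ) ⊕ gen (permTriple A P ρ))
                            (gen (permTriple A P γ))
  permTriple-homo P {σ} {ρ} {γ} γ≡σρ =
    comp P P P (permAct A σ) (permAct-iso A M σ) (permAct A ρ) (permAct-iso A M ρ)
               (permAct A γ) (permAct-iso A M γ)
               (λ z i → subst (λ j → z (γ ⟨$⟩ʳ i) ≈ᴹ z j) (γ≡σρ i) ≈ᴹ-refl)
    where
    M : RightModule A m ℓm
    M = FGP.mod P
    open RightModule M using (_≈ᴹ_; ≈ᴹ-refl)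

proposition16 : ∀ {r ℓr m ℓm : Level} (A : Ring r ℓr) (n : ℕ) → 4 ≤ n →
    (τ : Permutation n n) → IsDoubleTransposition τ →
    (P : FGP A m ℓm) →
    _∼_ A n (gen (permTriple A P τ)) 𝟘
proposition16 {m = m} {ℓm} A n _ τ τ-double P =
  PermutationHomomorphism.doubleTransposition⇒≈ε
    (K₁-abelianGroup A m ℓm n) (gen ∘ permTriple A P)
    (λ {σ ρ γ} → permTriple-homo A m ℓm n P {σ} {ρ} {γ}) τ τ-double
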